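{- R(lin) polynomially simulates Res(2): if $\pi$ is a Res(2) proof of a 2-DNF $D$ from a collection of 2-DNFs $K_1,\dots,K_t$, then there is an R(lin) proof of $\widehat D$ from $\widehat K_1,\dots,\widehat K_t$ whose size is polynomial in the size of $\pi$.
   Context: A 2-term is a conjunction of one or two literals; a 2-DNF is a disjunction of 2-terms; size of a 2-DNF = total number of literal occurrences. A Res(2) proof from $K$ is a sequence of 2-DNFs, each in $K$ or derived by: Cut (from $A\vee(l_1\wedge l_2)$ and $B\vee\neg l_1\vee\neg l_2$ derive $A\vee B$; literals not necessarily distinct); AND-introduction (from $A\vee l_1$ and $B\vee l_2$ derive $A\vee B\vee(l_1\wedge l_2)$); Weakening (from $A$ derive $A\vee(l_1\wedge l_2)$). Size = total size of lines. Translation: literal $x_i\mapsto x_i$, $\neg x_i\mapsto 1-x_i$; a 2-term $l_1\wedge l_2$ becomes the equation $\widehat l_1+\widehat l_2=2$ with constant terms moved to the right-hand side (so there is a single free term); a 2-DNF $D$ becomes the disjunction $\widehat D$ of the translations of its 2-terms. R(lin): linear equations with integer coefficients of size $\sum|a_i|$ (unary); disjunctions satisfied iff some equation holds; size = total size. An R(lin) proof from $K$: lines in $K$, Boolean axioms $(x_h=0)\vee(x_h=1)$, or derived by Resolution (from $A\vee L_1$, $B\vee L_2$ derive $A\vee B\vee(L_1\pm L_2)$), Weakening (from $A$ derive $A\vee L$), Simplification (from $A\vee(0=k)$, $k\ne0$, derive $A$). -}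

module Defs where

open import Data.Nat using (ℕ; zero; suc)
import Data.Nat as ℕ
open import Data.Integer using (ℤ; +_; -_; ∣_∣; _-_)
import Data.Integer as ℤ
open import Data.Fin using (Fin)
open import Data.Vec using (Vec; replicate; zipWith; _[_]≔_)
import Data.Vec as Vec
open import Data.List using (List; []; _∷_; _++_; [_]; map)
open import Data.Nat.ListAction using (sum)
open import Data.List.Membership.Propositional using (_∈_)
open import Data.List.Relation.Binary.Subset.Propositional using (_⊆_)
open import Data.Product using (Σ; _×_; ∃; _,_)
open import Relation.Binary.PropositionalEquality using (_≢_)

-- Common: disjunctions are lists read as SETS (order and repetitions
-- immaterial).  _≈ₛ_ is set equality of lists.

_≈ₛ_ : ∀ {A : Set} → List A → List A → Set
X ≈ₛ Y = (X ⊆ Y) × (Y ⊆ X)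

Occ : ∀ {A : Set} → List A → List (List A) → Set
Occ {A} E prev = Σ (List A) λ E' → (E' ∈ prev) × (E' ≈ₛ E)

data Lit (n : ℕ) : Set where
  pos : Fin n → Lit n
  neg : Fin n → Lit n

¬ₗ : ∀ {n} → Lit n → Lit n
¬ₗ (pos i) = neg i
¬ₗ (neg i) = pos i

-- a 2-term: conjunction of one or two literals (the two may coincide)
data Term (n : ℕ) : Set where
  one : Lit n → Term n
  two : Lit n → Lit n → Term n

DNF2 : ℕ → Set
DNF2 n = List (Term n)

termSize : ∀ {n} → Term n → ℕ
termSize (one _)   = 1
termSize (two _ _) = 2

dnfSize : ∀ {n} → DNF2 n → ℕ
dnfSize D = sum (map termSize D)

negTerm : ∀ {n} → Term n → DNF2 n
negTerm (one l)     = one (¬ₗ l) ∷ []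
negTerm (two l₁ l₂) = one (¬ₗ l₁) ∷ one (¬ₗ l₂) ∷ []

data Res2Rule {n : ℕ} (K : List (DNF2 n)) (prev : List (DNF2 n)) (D : DNF2 n) : Set where
  axiom   : D ∈ K → Res2Rule K prev D
  cut     : (A B : DNF2 n) (T : Term n) →
            Occ (A ++ [ T ]) prev → Occ (B ++ negTerm T) prev →
            D ≈ₛ (A ++ B) → Res2Rule K prev D
  and-intro : (A B : DNF2 n) (l₁ l₂ : Lit n) →
            Occ (A ++ [ one l₁ ]) prev → Occ (B ++ [ one l₂ ]) prev →
            D ≈ₛ (A ++ B ++ [ two l₁ l₂ ]) → Res2Rule K prev D
  weaken  : (A : DNF2 n) (T : Term n) → Occ A prev →
            D ≈ₛ (A ++ [ T ]) → Res2Rule K prev D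

-- a derivation; lines listed newest first
data Res2Deriv {n : ℕ} (K : List (DNF2 n)) : List (DNF2 n) → Set where
  []  : Res2Deriv K []
  _▷_ : ∀ {ls D} → Res2Deriv K ls → Res2Rule K ls D → Res2Deriv K (D ∷ ls)

Res2Proof : (n : ℕ) → List (DNF2 n) → DNF2 n → Set
Res2Proof n K D = Σ (List (DNF2 n)) λ ls → Res2Deriv K (D ∷ ls)

res2Size : ∀ {n K D} → Res2Proof n K D → ℕ
res2Size {D = D} (ls , _) = sum (map dnfSize (D ∷ ls))

-- the linear equation  Σ lhs[i] * x_i = rhs
infix 4 _≐_

record LinEq (n : ℕ) : Set where
  constructor _≐_
  field
    lhs : Vec ℤ n
    rhs : ℤ

Disj : ℕ → Set
Disj n = List (LinEq n)

eqSize : ∀ {n} → LinEq n → ℕ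
eqSize (c ≐ a) = Vec.sum (Vec.map ∣_∣ c) ℕ.+ ∣ a ∣

disjSize : ∀ {n} → Disj n → ℕ
disjSize D = sum (map eqSize D)

unitVec : ∀ {n} → Fin n → Vec ℤ n
unitVec {n} i = replicate n (+ 0) [ i ]≔ (+ 1)

_⊕_ : ∀ {n} → LinEq n → LinEq n → LinEq n
(c ≐ a) ⊕ (d ≐ b) = zipWith ℤ._+_ c d ≐ (a ℤ.+ b)

_⊖_ : ∀ {n} → LinEq n → LinEq n → LinEq n
(c ≐ a) ⊖ (d ≐ b) = zipWith ℤ._-_ c d ≐ (a ℤ.- b)

data RlinRule {n : ℕ} (K : List (Disj n)) (prev : List (Disj n)) (D : Disj n) : Set where
  axiom    : D ∈ K → RlinRule K prev D
  boolean  : (h : Fin n) →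
             D ≈ₛ ((unitVec h ≐ + 0) ∷ (unitVec h ≐ + 1) ∷ []) → RlinRule K prev D
  res-plus : (A B : Disj n) (L₁ L₂ : LinEq n) →
             Occ (A ++ [ L₁ ]) prev → Occ (B ++ [ L₂ ]) prev →
             D ≈ₛ (A ++ B ++ [ L₁ ⊕ L₂ ]) → RlinRule K prev D
  res-minus : (A B : Disj n) (L₁ L₂ : LinEq n) →
             Occ (A ++ [ L₁ ]) prev → Occ (B ++ [ L₂ ]) prev →
             D ≈ₛ (A ++ B ++ [ L₁ ⊖ L₂ ]) → RlinRule K prev D
  weaken   : (A : Disj n) (L : LinEq n) → Occ A prev →
             D ≈ₛ (A ++ [ L ]) → RlinRule K prev D
  simplify : (A : Disj n) (k : ℤ) → k ≢ + 0 →
             Occ (A ++ [ replicate n (+ 0) ≐ k ]) prev →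
             D ≈ₛ A → RlinRule K prev D

data RlinDeriv {n : ℕ} (K : List (Disj n)) : List (Disj n) → Set where
  []  : RlinDeriv K []
  _▷_ : ∀ {ls D} → RlinDeriv K ls → RlinRule K ls D → RlinDeriv K (D ∷ ls)

RlinProof : (n : ℕ) → List (Disj n) → Disj n → Set
RlinProof n K D = Σ (List (Disj n)) λ ls → RlinDeriv K (D ∷ ls)

rlinSize : ∀ {n K D} → RlinProof n K D → ℕ
rlinSize {D = D} (ls , _) = sum (map disjSize (D ∷ ls))

-- linear form of a literal as (coefficients, constant):
-- x_i ↦ x_i ,  ¬x_i ↦ 1 - x_i
litForm : ∀ {n} → Lit n → Vec ℤ n × ℤ
litForm (pos i) = unitVec i , + 0
litForm (neg i) = Vec.map -_ (unitVec i) , + 1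

-- l ↦ (l̂ = 1);  l₁ ∧ l₂ ↦ (l̂₁ + l̂₂ = 2), constants moved to the right
translateTerm : ∀ {n} → Term n → LinEq n
translateTerm (one l) with litForm l
... | c , a = c ≐ (+ 1 - a)
translateTerm (two l₁ l₂) with litForm l₁ | litForm l₂
... | c₁ , a₁ | c₂ , a₂ = zipWith ℤ._+_ c₁ c₂ ≐ ((+ 2 - a₁) - a₂)

translate : ∀ {n} → DNF2 n → Disj n
translate D = map translateTerm D

-- Each line D of the Res(2) proof is simulated by its translation D̂, preceded by at most
-- eleven auxiliary R(lin) lines.  Adding the equations l̂₁ = 1 and l̂₂ = 1 gives the
-- translation l̂₁ + l̂₂ = 2 of l₁ ∧ l₂, and adding l̂ = 1 to the translation of ¬l gives 0 = 1,
-- so axioms, weakening, AND-introduction and cuts on a literal take one or two R(lin) steps.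
-- A cut on l₁ ∧ l₂ adds l̂₁ + l̂₂ = 2 to the translation of ¬l₂, giving l̂₁ = 2, which the
-- Boolean axiom for the variable of l₁ refutes; then likewise for l₂.  Once the side
-- disjunctions of premises are replaced by sublists of earlier lines, every auxiliary line has
-- size O(|π|), and at most |π| + 1 lines need simulating, so the R(lin) proof has size O(|π|²).

module Submission where

open import Defs
open import Algebra.Bundles using (AbelianGroup)
import Algebra.Properties.AbelianGroup as AbelianGroupProperties
open import Data.Bool using (true; false)
open import Data.Fin as Fin using (Fin)
open import Data.Integer as ℤ using (ℤ; +_; -_; ∣_∣)
import Data.Integer.Properties as ℤ
open import Data.Integer.Tactic.RingSolver using (solve-∀)
open import Data.List using (List; []; _∷_; _++_; [_]; map; filter; length)
open import Data.List.Properties using (map-++; ++-assoc; length-++)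
open import Data.List.Membership.Propositional using (_∈_)
open import Data.List.Membership.Propositional.Properties
  using (∈-map⁺; ∈-++⁺ˡ; ∈-++⁺ʳ; ∈-++⁻; ∈-filter⁺; ∈-filter⁻)
import Data.List.Membership.DecPropositional as DecMembership
open import Data.List.Relation.Binary.Subset.Propositional using (_⊆_)
open import Data.List.Relation.Binary.Subset.Propositional.Properties
  using (⊆-refl; ⊆-trans; ++⁺; map⁺; xs⊆xs++ys)
open import Data.List.Relation.Unary.All as All using (All; []; _∷_)
import Data.List.Relation.Unary.All.Properties as All
open import Data.List.Relation.Unary.Any using (here; there)
open import Data.Nat using (ℕ; zero; suc; _+_; _*_; _^_; _≤_; z≤n; s≤s)
open import Data.Nat.ListAction using (sum)
open import Data.Nat.ListAction.Properties using (sum-++)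
open import Data.Nat.Properties
  using (≤-refl; ≤-trans; ≤-reflexive; +-mono-≤; +-monoʳ-≤; +-monoˡ-≤; *-monoˡ-≤; *-monoʳ-≤;
         m≤m+n; m≤n+m; n≤1+n; +-suc; +-assoc; *-distribˡ-+; module ≤-Reasoning)
import Data.Nat.Tactic.RingSolver as ℕ-Solver
open import Data.Product using (Σ; Σ-syntax; _×_; _,_; proj₁; proj₂)
open import Data.Sum using (_⊎_; inj₁; inj₂; reduce)
open import Data.Vec as Vec using (Vec; []; _∷_; replicate; zipWith)
open import Data.Vec.Properties
  using (zipWith-assoc; zipWith-identityˡ; zipWith-identityʳ; zipWith-inverseˡ; zipWith-inverseʳ;
         zipWith-comm; zipWith-map₂)
open import Function using (_$_)
open import Level using (0ℓ)
open import Relation.Binary.Definitions using (DecidableEquality)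
open import Relation.Binary.PropositionalEquality hiding ([_])
open import Relation.Nullary.Decidable as Dec using (Dec; no; _×-dec_)

module _ {A : Set} where

  ≈ₛ-refl : {X : List A} → X ≈ₛ X
  ≈ₛ-refl = ⊆-refl , ⊆-refl

  ≈ₛ-sym : {X Y : List A} → X ≈ₛ Y → Y ≈ₛ X
  ≈ₛ-sym (X⊆Y , Y⊆X) = Y⊆X , X⊆Y

  ≈ₛ-trans : {X Y Z : List A} → X ≈ₛ Y → Y ≈ₛ Z → X ≈ₛ Z
  ≈ₛ-trans (X⊆Y , Y⊆X) (Y⊆Z , Z⊆Y) = ⊆-trans X⊆Y Y⊆Z , ⊆-trans Z⊆Y Y⊆X

  ≡⇒≈ₛ : {X Y : List A} → X ≡ Y → X ≈ₛ Y
  ≡⇒≈ₛ refl = ≈ₛ-refl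

  ++-cong-≈ₛ : {X X′ Y Y′ : List A} → X ≈ₛ X′ → Y ≈ₛ Y′ → (X ++ Y) ≈ₛ (X′ ++ Y′)
  ++-cong-≈ₛ (X⊆ , ⊇X) (Y⊆ , ⊇Y) = ++⁺ X⊆ Y⊆ , ++⁺ ⊇X ⊇Y

  ++-idem-≈ₛ : (X : List A) → (X ++ X) ≈ₛ X
  ++-idem-≈ₛ X = (λ x∈ → reduce (∈-++⁻ X x∈)) , xs⊆xs++ys X X

  ++-absorb-≈ₛ : (X Y : List A) → (X ++ (X ++ Y)) ≈ₛ (X ++ Y)
  ++-absorb-≈ₛ X Y =
    ≈ₛ-trans (≡⇒≈ₛ (sym (++-assoc X X Y))) (++-cong-≈ₛ (++-idem-≈ₛ X) ≈ₛ-refl)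

map-cong-≈ₛ : {A B : Set} (f : A → B) {X Y : List A} → X ≈ₛ Y → map f X ≈ₛ map f Y
map-cong-≈ₛ f (X⊆Y , Y⊆X) = map⁺ f X⊆Y , map⁺ f Y⊆X

module _ {A : Set} where

  Occ-resp : {E E′ : List A} {R : List (List A)} → E ≈ₛ E′ → Occ E R → Occ E′ R
  Occ-resp E≈E′ (F , F∈ , F≈E) = F , F∈ , ≈ₛ-trans F≈E E≈E′

  Occ-head : {E E′ : List A} {R : List (List A)} → E ≈ₛ E′ → Occ E′ (E ∷ R)
  Occ-head {E} E≈E′ = E , here refl , E≈E′

  Occ-++ : {E : List A} {R : List (List A)} (xs : List (List A)) → Occ E R → Occ E (xs ++ R)
  Occ-++ xs (F , F∈ , F≈E) = F , ∈-++⁺ʳ xs F∈ , F≈E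

m+k≡n⇒m≤n : ∀ {m n} k → m + k ≡ n → m ≤ n
m+k≡n⇒m≤n {m} k refl = m≤m+n m k

module _ {A : Set} (f : A → ℕ) where

  ∈⇒≤sum-map : {x : A} {xs : List A} → x ∈ xs → f x ≤ sum (map f xs)
  ∈⇒≤sum-map {xs = y ∷ ys} (here refl) = m≤m+n (f y) _
  ∈⇒≤sum-map {xs = y ∷ ys} (there x∈) = ≤-trans (∈⇒≤sum-map x∈) (m≤n+m _ (f y))

  sum-map-filter-≤ : {P : A → Set} (P? : ∀ x → Dec (P x)) (xs : List A) →
                     sum (map f (filter P? xs)) ≤ sum (map f xs)
  sum-map-filter-≤ P? [] = z≤n
  sum-map-filter-≤ P? (x ∷ xs) with Dec.does (P? x)
  ... | true  = +-monoʳ-≤ (f x) (sum-map-filter-≤ P? xs)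
  ... | false = ≤-trans (sum-map-filter-≤ P? xs) (m≤n+m _ (f x))

  sum-map-++ : (xs ys : List A) → sum (map f (xs ++ ys)) ≡ sum (map f xs) + sum (map f ys)
  sum-map-++ xs ys = trans (cong sum (map-++ f xs ys)) (sum-++ (map f xs) (map f ys))

  sum-map-≤-length* : {m : ℕ} {xs : List A} → All (λ x → f x ≤ m) xs → sum (map f xs) ≤ length xs * m
  sum-map-≤-length* []         = z≤n
  sum-map-≤-length* (fx≤m ∷ p) = +-mono-≤ fx≤m (sum-map-≤-length* p)

vecAbelianGroup : ℕ → AbelianGroup 0ℓ 0ℓ
vecAbelianGroup n = record
  { Carrier        = Vec ℤ n
  ; _≈_            = _≡_
  ; _∙_            = zipWith ℤ._+_
  ; ε              = replicate n (+ 0)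
  ; _⁻¹            = Vec.map -_
  ; isAbelianGroup = record
    { isGroup = record
      { isMonoid = record
        { isSemigroup = record
          { isMagma = record { isEquivalence = isEquivalence ; ∙-cong = cong₂ (zipWith ℤ._+_) }
          ; assoc   = zipWith-assoc ℤ.+-assoc
          }
        ; identity = zipWith-identityˡ ℤ.+-identityˡ , zipWith-identityʳ ℤ.+-identityʳ
        }
      ; inverse = zipWith-inverseˡ ℤ.+-inverseˡ , zipWith-inverseʳ ℤ.+-inverseʳ
      ; ⁻¹-cong = cong (Vec.map -_)
      }
    ; comm = zipWith-comm ℤ.+-comm
    }
  }

‖_‖₁ : ∀ {n} → Vec ℤ n → ℕ
‖ v ‖₁ = Vec.sum (Vec.map ∣_∣ v)

‖0‖₁≡0 : ∀ n → ‖ replicate n (+ 0) ‖₁ ≡ 0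
‖0‖₁≡0 zero    = refl
‖0‖₁≡0 (suc n) = ‖0‖₁≡0 n

‖unitVec‖₁≡1 : ∀ {n} (i : Fin n) → ‖ unitVec i ‖₁ ≡ 1
‖unitVec‖₁≡1 {suc n} Fin.zero    = cong suc (‖0‖₁≡0 n)
‖unitVec‖₁≡1 {suc n} (Fin.suc i) = ‖unitVec‖₁≡1 i

‖-v‖₁≡‖v‖₁ : ∀ {n} (v : Vec ℤ n) → ‖ Vec.map -_ v ‖₁ ≡ ‖ v ‖₁
‖-v‖₁≡‖v‖₁ []      = refl
‖-v‖₁≡‖v‖₁ (x ∷ v) = cong₂ _+_ (ℤ.∣-i∣≡∣i∣ x) (‖-v‖₁≡‖v‖₁ v)

‖v+w‖₁≤‖v‖₁+‖w‖₁ : ∀ {n} (v w : Vec ℤ n) → ‖ zipWith ℤ._+_ v w ‖₁ ≤ ‖ v ‖₁ + ‖ w ‖₁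
‖v+w‖₁≤‖v‖₁+‖w‖₁ []      []      = z≤n
‖v+w‖₁≤‖v‖₁+‖w‖₁ (x ∷ v) (y ∷ w) = begin
  ∣ x ℤ.+ y ∣ + ‖ zipWith ℤ._+_ v w ‖₁  ≤⟨ +-mono-≤ (ℤ.∣i+j∣≤∣i∣+∣j∣ x y) (‖v+w‖₁≤‖v‖₁+‖w‖₁ v w) ⟩
  (∣ x ∣ + ∣ y ∣) + (‖ v ‖₁ + ‖ w ‖₁)   ≡⟨ +-interchange ∣ x ∣ ∣ y ∣ ‖ v ‖₁ ‖ w ‖₁ ⟩
  (∣ x ∣ + ‖ v ‖₁) + (∣ y ∣ + ‖ w ‖₁)   ∎
  where
  open ≤-Reasoning
  +-interchange : ∀ a b c d → (a + b) + (c + d) ≡ (a + c) + (b + d)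
  +-interchange = ℕ-Solver.solve-∀

module _ {n : ℕ} where

  open AbelianGroup (vecAbelianGroup n) using (_∙_; ε; _⁻¹; inverseˡ; inverseʳ)
  open AbelianGroupProperties (vecAbelianGroup n) using (xyx⁻¹≈y; //-rightDividesʳ; ⁻¹-involutive)

  coeff : Lit n → Vec ℤ n
  coeff l = proj₁ (litForm l)

  offset : Lit n → ℤ
  offset l = proj₂ (litForm l)

  coeff-¬ₗ : (l : Lit n) → coeff (¬ₗ l) ≡ coeff l ⁻¹
  coeff-¬ₗ (pos i) = refl
  coeff-¬ₗ (neg i) = sym (⁻¹-involutive (unitVec i))

  offset-¬ₗ : (l : Lit n) → offset (¬ₗ l) ≡ + 1 ℤ.- offset l
  offset-¬ₗ (pos i) = refl
  offset-¬ₗ (neg i) = refl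

  ‖coeff‖₁≡1 : (l : Lit n) → ‖ coeff l ‖₁ ≡ 1
  ‖coeff‖₁≡1 (pos i) = ‖unitVec‖₁≡1 i
  ‖coeff‖₁≡1 (neg i) = trans (‖-v‖₁≡‖v‖₁ (unitVec i)) (‖unitVec‖₁≡1 i)

  -- the equation l̂ = 2, which no 0/1 assignment satisfies
  lit≐2 : Lit n → LinEq n
  lit≐2 l = coeff l ≐ + 2 ℤ.- offset l

  one⊕one≡two : (l₁ l₂ : Lit n) →
                translateTerm (one l₁) ⊕ translateTerm (one l₂) ≡ translateTerm (two l₁ l₂)
  one⊕one≡two l₁ l₂ = cong (coeff l₁ ∙ coeff l₂ ≐_) (constants (offset l₁) (offset l₂))
    where
    constants : ∀ a₁ a₂ → (+ 1 ℤ.- a₁) ℤ.+ (+ 1 ℤ.- a₂) ≡ (+ 2 ℤ.- a₁) ℤ.- a₂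
    constants = solve-∀

  one⊕¬one≡0≐1 : (l : Lit n) → translateTerm (one l) ⊕ translateTerm (one (¬ₗ l)) ≡ (ε ≐ + 1)
  one⊕¬one≡0≐1 l = cong₂ _≐_
    (trans (cong (coeff l ∙_) (coeff-¬ₗ l)) (inverseʳ (coeff l)))
    (trans (cong (λ b → (+ 1 ℤ.- a) ℤ.+ (+ 1 ℤ.- b)) (offset-¬ₗ l)) (constants a))
    where
    a : ℤ
    a = offset l
    constants : ∀ a → (+ 1 ℤ.- a) ℤ.+ (+ 1 ℤ.- (+ 1 ℤ.- a)) ≡ + 1
    constants = solve-∀

  two⊕¬first≡lit≐2 : (l₁ l₂ : Lit n) →
                     translateTerm (two l₁ l₂) ⊕ translateTerm (one (¬ₗ l₁)) ≡ lit≐2 l₂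
  two⊕¬first≡lit≐2 l₁ l₂ = cong₂ _≐_
    (trans (cong (coeff l₁ ∙ coeff l₂ ∙_) (coeff-¬ₗ l₁)) (xyx⁻¹≈y (coeff l₁) (coeff l₂)))
    (trans (cong (λ b → ((+ 2 ℤ.- a₁) ℤ.- a₂) ℤ.+ (+ 1 ℤ.- b)) (offset-¬ₗ l₁)) (constants a₁ a₂))
    where
    a₁ a₂ : ℤ
    a₁ = offset l₁
    a₂ = offset l₂
    constants : ∀ a₁ a₂ → ((+ 2 ℤ.- a₁) ℤ.- a₂) ℤ.+ (+ 1 ℤ.- (+ 1 ℤ.- a₁)) ≡ + 2 ℤ.- a₂
    constants = solve-∀

  two⊕¬second≡lit≐2 : (l₁ l₂ : Lit n) →
                      translateTerm (two l₁ l₂) ⊕ translateTerm (one (¬ₗ l₂)) ≡ lit≐2 l₁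
  two⊕¬second≡lit≐2 l₁ l₂ = cong₂ _≐_
    (trans (cong (coeff l₁ ∙ coeff l₂ ∙_) (coeff-¬ₗ l₂)) (//-rightDividesʳ (coeff l₂) (coeff l₁)))
    (trans (cong (λ b → ((+ 2 ℤ.- a₁) ℤ.- a₂) ℤ.+ (+ 1 ℤ.- b)) (offset-¬ₗ l₂)) (constants a₁ a₂))
    where
    a₁ a₂ : ℤ
    a₁ = offset l₁
    a₂ = offset l₂
    constants : ∀ a₁ a₂ → ((+ 2 ℤ.- a₁) ℤ.- a₂) ℤ.+ (+ 1 ℤ.- (+ 1 ℤ.- a₂)) ≡ + 2 ℤ.- a₁
    constants = solve-∀

  ⊖-cancel : (c : Vec ℤ n) (a b : ℤ) → (c ≐ a) ⊖ (c ≐ b) ≡ (ε ≐ a ℤ.- b)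
  ⊖-cancel c a b = cong (_≐ a ℤ.- b) (trans (sym (zipWith-map₂ ℤ._+_ -_ c c)) (inverseʳ c))

  ⁻¹⊕-cancel : (c : Vec ℤ n) (a b : ℤ) → (c ⁻¹ ≐ a) ⊕ (c ≐ b) ≡ (ε ≐ a ℤ.+ b)
  ⁻¹⊕-cancel c a b = cong (_≐ a ℤ.+ b) (inverseˡ c)

module _ {n : ℕ} where

  disjSize-++-≤ : (X Y : Disj n) {x y : ℕ} → disjSize X ≤ x → disjSize Y ≤ y → disjSize (X ++ Y) ≤ x + y
  disjSize-++-≤ X Y X≤x Y≤y = ≤-trans (≤-reflexive (sum-map-++ eqSize X Y)) (+-mono-≤ X≤x Y≤y)

  eqSize-0≐ : (k : ℤ) → eqSize (replicate n (+ 0) ≐ k) ≡ ∣ k ∣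
  eqSize-0≐ k = cong (_+ ∣ k ∣) (‖0‖₁≡0 n)

  eqSize-unitVec≐ : (i : Fin n) (k : ℤ) → eqSize (unitVec i ≐ k) ≡ suc ∣ k ∣
  eqSize-unitVec≐ i k = cong (_+ ∣ k ∣) (‖unitVec‖₁≡1 i)

  ∣1-offset∣≤1 : (l : Lit n) → ∣ + 1 ℤ.- offset l ∣ ≤ 1
  ∣1-offset∣≤1 (pos i) = ≤-refl
  ∣1-offset∣≤1 (neg i) = z≤n

  ∣2-offset∣≤2 : (l : Lit n) → ∣ + 2 ℤ.- offset l ∣ ≤ 2
  ∣2-offset∣≤2 (pos i) = ≤-refl
  ∣2-offset∣≤2 (neg i) = s≤s z≤n

  ∣2-offset-offset∣≤2 : (l₁ l₂ : Lit n) → ∣ (+ 2 ℤ.- offset l₁) ℤ.- offset l₂ ∣ ≤ 2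
  ∣2-offset-offset∣≤2 (pos i) (pos j) = ≤-refl
  ∣2-offset-offset∣≤2 (pos i) (neg j) = s≤s z≤n
  ∣2-offset-offset∣≤2 (neg i) (pos j) = s≤s z≤n
  ∣2-offset-offset∣≤2 (neg i) (neg j) = z≤n

  lit≐2-size : (l : Lit n) → eqSize (lit≐2 l) ≤ 3
  lit≐2-size l = +-mono-≤ (≤-reflexive (‖coeff‖₁≡1 l)) (∣2-offset∣≤2 l)

  translateTerm-size : (T : Term n) → eqSize (translateTerm T) ≤ 2 * termSize T
  translateTerm-size (one l)     = +-mono-≤ (≤-reflexive (‖coeff‖₁≡1 l)) (∣1-offset∣≤1 l)
  translateTerm-size (two l₁ l₂) = +-mono-≤ ‖coeff+coeff‖₁≤2 (∣2-offset-offset∣≤2 l₁ l₂)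
    where
    ‖coeff+coeff‖₁≤2 : ‖ zipWith ℤ._+_ (coeff l₁) (coeff l₂) ‖₁ ≤ 2
    ‖coeff+coeff‖₁≤2 = ≤-trans (‖v+w‖₁≤‖v‖₁+‖w‖₁ (coeff l₁) (coeff l₂))
                               (≤-reflexive (cong₂ _+_ (‖coeff‖₁≡1 l₁) (‖coeff‖₁≡1 l₂)))

  translate-size : (D : DNF2 n) → disjSize (translate D) ≤ 2 * dnfSize D
  translate-size []      = z≤n
  translate-size (T ∷ D) = ≤-trans (+-mono-≤ (translateTerm-size T) (translate-size D))
                                   (≤-reflexive (sym (*-distribˡ-+ 2 (termSize T) (dnfSize D))))

_≟ₗ_ : ∀ {n} → DecidableEquality (Lit n)
pos i ≟ₗ pos j = Dec.map′ (cong pos) (λ { refl → refl }) (i Fin.≟ j)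
pos _ ≟ₗ neg _ = no λ ()
neg _ ≟ₗ pos _ = no λ ()
neg i ≟ₗ neg j = Dec.map′ (cong neg) (λ { refl → refl }) (i Fin.≟ j)

_≟ₜ_ : ∀ {n} → DecidableEquality (Term n)
one l₁    ≟ₜ one l₂    = Dec.map′ (cong one) (λ { refl → refl }) (l₁ ≟ₗ l₂)
one _     ≟ₜ two _ _   = no λ ()
two _ _   ≟ₜ one _     = no λ ()
two l₁ l₂ ≟ₜ two l₃ l₄ =
  Dec.map′ (λ (p , q) → cong₂ two p q) (λ { refl → refl , refl }) ((l₁ ≟ₗ l₃) ×-dec (l₂ ≟ₗ l₄))

totalSize : ∀ {n} → List (DNF2 n) → ℕ
totalSize ls = sum (map dnfSize ls)

module _ {n : ℕ} where

  open DecMembership (_≟ₜ_ {n}) using (_∈?_)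

  restrict : DNF2 n → DNF2 n → DNF2 n
  restrict A E = filter (_∈? A) E

  restrict-≈ₛ : {A E : DNF2 n} → A ⊆ E → restrict A E ≈ₛ A
  restrict-≈ₛ {A} {E} A⊆E = (λ t∈ → proj₂ (∈-filter⁻ (_∈? A) {xs = E} t∈)) , (λ t∈ → ∈-filter⁺ (_∈? A) (A⊆E t∈) t∈)

  -- The side A of a premise A ∨ Z may be an arbitrarily long list; the set-equal
  -- sublist of the premise line itself is bounded by the size of the proof so far.
  small-side : {A Z : DNF2 n} {ls : List (DNF2 n)} → Occ (A ++ Z) ls →
               Σ[ A′ ∈ DNF2 n ] A′ ≈ₛ A × dnfSize A′ ≤ totalSize ls × Occ (A′ ++ Z) ls
  small-side {A} (E , E∈ , E≈A++Z) =
      restrict A E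
    , A′≈A
    , ≤-trans (sum-map-filter-≤ termSize (_∈? A) E) (∈⇒≤sum-map dnfSize E∈)
    , (E , E∈ , ≈ₛ-trans E≈A++Z (++-cong-≈ₛ (≈ₛ-sym A′≈A) ≈ₛ-refl))
    where
    A′≈A = restrict-≈ₛ (λ t∈ → proj₂ E≈A++Z (∈-++⁺ˡ t∈))

  Simulates : List (DNF2 n) → List (Disj n) → Set
  Simulates ls R = ∀ {E} → E ∈ ls → Occ (translate E) R

  translate-≈ₛ : {D A B : DNF2 n} → D ≈ₛ (A ++ B) → translate D ≈ₛ (translate A ++ translate B)
  translate-≈ₛ {A = A} {B} D≈ = ≈ₛ-trans (map-cong-≈ₛ translateTerm D≈) (≡⇒≈ₛ (map-++ translateTerm A B))

  translate-Occ : {E : DNF2 n} {ls : List (DNF2 n)} {R : List (Disj n)} →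
                  Simulates ls R → Occ E ls → Occ (translate E) R
  translate-Occ sim (E′ , E′∈ , E′≈E) = Occ-resp (map-cong-≈ₛ translateTerm E′≈E) (sim E′∈)

  translate-Occ-++ : {A Z : DNF2 n} {ls : List (DNF2 n)} {R : List (Disj n)} →
                     Simulates ls R → Occ (A ++ Z) ls → Occ (translate A ++ translate Z) R
  translate-Occ-++ {A = A} {Z = Z} sim o = Occ-resp (≡⇒≈ₛ (map-++ translateTerm A Z)) (translate-Occ sim o)

module Extensions {n : ℕ} (Γ : List (Disj n)) where

  open AbelianGroup (vecAbelianGroup n) using (ε; _⁻¹)

  _⊑_ : List (Disj n) → List (Disj n) → Set
  R ⊑ R′ = ∀ {E} → Occ E R → Occ E R′

  Extension : List (Disj n) → Disj n → ℕ → ℕ → Set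
  Extension R Y k m = RlinDeriv Γ R →
    Σ[ aux ∈ List (Disj n) ] RlinDeriv Γ (Y ∷ aux ++ R) × length aux ≤ k × All (λ w → disjSize w ≤ m) aux

  byRule : ∀ {R Y m} → RlinRule Γ R Y → Extension R Y 0 m
  byRule r d = [] , d ▷ r , z≤n , []

  Extension-mono : ∀ {R Y k k′ m m′} → k ≤ k′ → m ≤ m′ → Extension R Y k m → Extension R Y k′ m′
  Extension-mono k≤k′ m≤m′ e d with e d
  ... | aux , d′ , aux≤k , aux≤m = aux , d′ , ≤-trans aux≤k k≤k′ , All.map (λ w≤m → ≤-trans w≤m m≤m′) aux≤m

  chain : ∀ {R Y₁ Y₂ k₁ k₂ m} → Extension R Y₁ k₁ m → disjSize Y₁ ≤ m →
          (∀ {R′} → R ⊑ R′ → Occ Y₁ R′ → Extension R′ Y₂ k₂ m) → Extension R Y₂ (k₂ + suc k₁) m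
  chain {R} {Y₁} {Y₂} e₁ Y₁≤m e₂ d with e₁ d
  ... | aux₁ , d₁ , aux₁≤k₁ , aux₁≤m with e₂ (Occ-++ (Y₁ ∷ aux₁)) (Occ-head ≈ₛ-refl) d₁
  ... | aux₂ , d₂ , aux₂≤k₂ , aux₂≤m =
      aux₂ ++ Y₁ ∷ aux₁
    , subst (λ ls → RlinDeriv Γ (Y₂ ∷ ls)) (sym (++-assoc aux₂ (Y₁ ∷ aux₁) R)) d₂
    , ≤-trans (≤-reflexive (length-++ aux₂)) (+-mono-≤ aux₂≤k₂ (s≤s aux₁≤k₁))
    , All.++⁺ aux₂≤m (Y₁≤m ∷ aux₁≤m)

  eliminationLines : Fin n → Disj n → ℤ → ℤ → List (Disj n)
  eliminationLines h X k₁ k₂ =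
      (X ++ X ++ [ ε ≐ k₂ ])
    ∷ (X ++ [ unitVec h ≐ + 0 ])
    ∷ (X ++ [ unitVec h ≐ + 0 ] ++ [ ε ≐ k₁ ])
    ∷ ((unitVec h ≐ + 0) ∷ (unitVec h ≐ + 1) ∷ [])
    ∷ []

  eliminationLines-size : (h : Fin n) (X : Disj n) {k₁ k₂ : ℤ} → ∣ k₁ ∣ ≤ 2 → ∣ k₂ ∣ ≤ 2 →
    All (λ w → disjSize w ≤ disjSize X + (disjSize X + 3)) (eliminationLines h X k₁ k₂)
  eliminationLines-size h X {k₁} {k₂} k₁≤2 k₂≤2 =
      disjSize-++-≤ X _ ≤-refl (disjSize-++-≤ X _ ≤-refl (+-mono-≤ (≤-trans 0≐k₂-size (n≤1+n 2)) z≤n))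
    ∷ disjSize-++-≤ X _ ≤-refl (≤x+3 (≤-trans (+-mono-≤ unit-size (z≤n {0})) (s≤s z≤n)))
    ∷ disjSize-++-≤ X _ ≤-refl (≤x+3 (+-mono-≤ unit-size (+-mono-≤ 0≐k₁-size z≤n)))
    ∷ ≤-trans (≤x+3 (+-mono-≤ unit-size (+-mono-≤ (≤-reflexive (eqSize-unitVec≐ h (+ 1))) z≤n)))
              (m≤n+m _ (disjSize X))
    ∷ []
    where
    ≤x+3 : ∀ {k} → k ≤ 3 → k ≤ disjSize X + 3
    ≤x+3 k≤3 = ≤-trans k≤3 (m≤n+m 3 (disjSize X))
    unit-size : eqSize (unitVec h ≐ + 0) ≤ 1
    unit-size = ≤-reflexive (eqSize-unitVec≐ h (+ 0))
    0≐k₁-size : eqSize (ε ≐ k₁) ≤ 2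
    0≐k₁-size = ≤-trans (≤-reflexive (eqSize-0≐ {n} k₁)) k₁≤2
    0≐k₂-size : eqSize (ε ≐ k₂) ≤ 2
    0≐k₂-size = ≤-trans (≤-reflexive (eqSize-0≐ {n} k₂)) k₂≤2

  -- X ∨ (l̂ = 2) yields X: resolving against the Boolean axiom of the variable of l
  -- leaves only contradictions 0 = k besides X.
  eliminate : ∀ {R X Y} (l : Lit n) → Occ (X ++ [ lit≐2 l ]) R → Y ≈ₛ X →
              Extension R Y 4 (disjSize X + (disjSize X + 3))
  eliminate {R} {X} {Y} (pos h) X∨x≐2 Y≈X d =
    eliminationLines h X (+ 1) (+ 2) , d₅ , ≤-refl , eliminationLines-size h X (s≤s z≤n) ≤-refl
    where
    x : Vec ℤ n
    x = unitVec h
    boolean-x : Disj n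
    boolean-x = (x ≐ + 0) ∷ (x ≐ + 1) ∷ []
    d₁ : RlinDeriv Γ (boolean-x ∷ R)
    d₁ = d ▷ boolean h ≈ₛ-refl
    d₂ : RlinDeriv Γ ((X ++ [ x ≐ + 0 ] ++ [ ε ≐ + 1 ]) ∷ boolean-x ∷ R)
    d₂ = d₁ ▷ res-minus X [ x ≐ + 0 ] (x ≐ + 2) (x ≐ + 1) (Occ-++ [ boolean-x ] X∨x≐2) (Occ-head ≈ₛ-refl)
                (≡⇒≈ₛ (cong (λ L → X ++ [ x ≐ + 0 ] ++ [ L ]) (sym (⊖-cancel x (+ 2) (+ 1)))))
    d₃ : RlinDeriv Γ ((X ++ [ x ≐ + 0 ]) ∷ (X ++ [ x ≐ + 0 ] ++ [ ε ≐ + 1 ]) ∷ boolean-x ∷ R)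
    d₃ = d₂ ▷ simplify (X ++ [ x ≐ + 0 ]) (+ 1) (λ ()) (Occ-head (≡⇒≈ₛ (sym (++-assoc X _ _)))) ≈ₛ-refl
    d₄ : RlinDeriv Γ (eliminationLines h X (+ 1) (+ 2) ++ R)
    d₄ = d₃ ▷ res-minus X X (x ≐ + 2) (x ≐ + 0) (Occ-++ (_ ∷ _ ∷ _ ∷ []) X∨x≐2) (Occ-head ≈ₛ-refl)
                (≡⇒≈ₛ (cong (λ L → X ++ X ++ [ L ]) (sym (⊖-cancel x (+ 2) (+ 0)))))
    d₅ : RlinDeriv Γ (Y ∷ eliminationLines h X (+ 1) (+ 2) ++ R)
    d₅ = d₄ ▷ simplify (X ++ X) (+ 2) (λ ()) (Occ-head (≡⇒≈ₛ (sym (++-assoc X X _))))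
                (≈ₛ-trans Y≈X (≈ₛ-sym (++-idem-≈ₛ X)))
  eliminate {R} {X} {Y} (neg h) X∨-x≐1 Y≈X d =
    eliminationLines h X (+ 2) (+ 1) , d₅ , ≤-refl , eliminationLines-size h X ≤-refl (s≤s z≤n)
    where
    x : Vec ℤ n
    x = unitVec h
    boolean-x : Disj n
    boolean-x = (x ≐ + 0) ∷ (x ≐ + 1) ∷ []
    d₁ : RlinDeriv Γ (boolean-x ∷ R)
    d₁ = d ▷ boolean h ≈ₛ-refl
    d₂ : RlinDeriv Γ ((X ++ [ x ≐ + 0 ] ++ [ ε ≐ + 2 ]) ∷ boolean-x ∷ R)
    d₂ = d₁ ▷ res-plus X [ x ≐ + 0 ] (x ⁻¹ ≐ + 1) (x ≐ + 1) (Occ-++ [ boolean-x ] X∨-x≐1) (Occ-head ≈ₛ-refl)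
                (≡⇒≈ₛ (cong (λ L → X ++ [ x ≐ + 0 ] ++ [ L ]) (sym (⁻¹⊕-cancel x (+ 1) (+ 1)))))
    d₃ : RlinDeriv Γ ((X ++ [ x ≐ + 0 ]) ∷ (X ++ [ x ≐ + 0 ] ++ [ ε ≐ + 2 ]) ∷ boolean-x ∷ R)
    d₃ = d₂ ▷ simplify (X ++ [ x ≐ + 0 ]) (+ 2) (λ ()) (Occ-head (≡⇒≈ₛ (sym (++-assoc X _ _)))) ≈ₛ-refl
    d₄ : RlinDeriv Γ (eliminationLines h X (+ 2) (+ 1) ++ R)
    d₄ = d₃ ▷ res-plus X X (x ⁻¹ ≐ + 1) (x ≐ + 0) (Occ-++ (_ ∷ _ ∷ _ ∷ []) X∨-x≐1) (Occ-head ≈ₛ-refl)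
                (≡⇒≈ₛ (cong (λ L → X ++ X ++ [ L ]) (sym (⁻¹⊕-cancel x (+ 1) (+ 0)))))
    d₅ : RlinDeriv Γ (Y ∷ eliminationLines h X (+ 2) (+ 1) ++ R)
    d₅ = d₄ ▷ simplify (X ++ X) (+ 1) (λ ()) (Occ-head (≡⇒≈ₛ (sym (++-assoc X X _))))
                (≈ₛ-trans Y≈X (≈ₛ-sym (++-idem-≈ₛ X)))

  cutOne : ∀ {R A B Y} (l : Lit n) →
           Occ (A ++ [ translateTerm (one l) ]) R → Occ (B ++ [ translateTerm (one (¬ₗ l)) ]) R →
           Y ≈ₛ (A ++ B) → Extension R Y 1 (disjSize A + (disjSize B + 1))
  cutOne {R} {A} {B} l A∨l B∨¬l Y≈A++B =
    chain (byRule (res-plus A B _ _ A∨l B∨¬l (≡⇒≈ₛ (cong (λ L → A ++ B ++ [ L ]) (sym (one⊕¬one≡0≐1 l))))))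
          (disjSize-++-≤ A _ ≤-refl (disjSize-++-≤ B _ ≤-refl (≤-reflexive (cong (_+ 0) (eqSize-0≐ {n} (+ 1))))))
          λ _ A∨B∨0≐1 → byRule (simplify (A ++ B) (+ 1) (λ ())
                                  (Occ-resp (≡⇒≈ₛ (sym (++-assoc A B _))) A∨B∨0≐1) Y≈A++B)

  eliminate-after : ∀ {R X Y c} (l : Lit n) → RlinRule Γ R (X ++ [ lit≐2 l ]) → Y ≈ₛ X → disjSize X ≤ c →
                    Extension R Y 5 (c + (c + 3))
  eliminate-after {X = X} {c = c} l r Y≈X X≤c =
    chain (byRule r) (≤-trans (disjSize-++-≤ X _ X≤c (+-mono-≤ (lit≐2-size l) z≤n)) (+-monoʳ-≤ c (m≤n+m 3 c)))
          λ _ X∨l≐2 → Extension-mono ≤-refl (+-mono-≤ X≤c (+-monoˡ-≤ 3 X≤c)) (eliminate l X∨l≐2 Y≈X)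

  cutTwo : ∀ {R A B Y} (l₁ l₂ : Lit n) →
           Occ (A ++ [ translateTerm (two l₁ l₂) ]) R →
           Occ (B ++ translateTerm (one (¬ₗ l₁)) ∷ translateTerm (one (¬ₗ l₂)) ∷ []) R →
           Y ≈ₛ (A ++ B) → Extension R Y 11 (4 * (disjSize A + disjSize B) + 8)
  cutTwo {R} {A} {B} l₁ l₂ A∨T B∨N₁∨N₂ Y≈A++B =
    chain (Extension-mono ≤-refl (bound₁ a b)
            (eliminate-after l₁ (res-plus A (B ++ [ N₁ ]) T N₂ A∨T B∨N₁∨N₂′ (≡⇒≈ₛ X₁∨l₁≐2≡)) ≈ₛ-refl X₁≤))
          (≤-trans X₁≤ (≤-trans (m≤m+n _ _) (bound₁ a b))) λ ext X₁∈ →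
    Extension-mono ≤-refl (bound₂ a b)
      (eliminate-after l₂ (res-plus A (A ++ B) T N₁ (ext A∨T) (Occ-resp (≡⇒≈ₛ (sym (++-assoc A B [ N₁ ]))) X₁∈)
                                    (≡⇒≈ₛ X₂∨l₂≐2≡))
                       (≈ₛ-trans Y≈A++B (≈ₛ-sym (++-absorb-≈ₛ A B))) X₂≤)
    where
    T N₁ N₂ : LinEq n
    T  = translateTerm (two l₁ l₂)
    N₁ = translateTerm (one (¬ₗ l₁))
    N₂ = translateTerm (one (¬ₗ l₂))
    a b : ℕ
    a = disjSize A
    b = disjSize B

    B∨N₁∨N₂′ : Occ ((B ++ [ N₁ ]) ++ [ N₂ ]) R
    B∨N₁∨N₂′ = Occ-resp (≡⇒≈ₛ (sym (++-assoc B [ N₁ ] [ N₂ ]))) B∨N₁∨N₂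
    X₁∨l₁≐2≡ : (A ++ (B ++ [ N₁ ])) ++ [ lit≐2 l₁ ] ≡ A ++ (B ++ [ N₁ ]) ++ [ T ⊕ N₂ ]
    X₁∨l₁≐2≡ = trans (++-assoc A (B ++ [ N₁ ]) _)
                     (cong (λ L → A ++ (B ++ [ N₁ ]) ++ [ L ]) (sym (two⊕¬second≡lit≐2 l₁ l₂)))
    X₂∨l₂≐2≡ : (A ++ (A ++ B)) ++ [ lit≐2 l₂ ] ≡ A ++ (A ++ B) ++ [ T ⊕ N₁ ]
    X₂∨l₂≐2≡ = trans (++-assoc A (A ++ B) _)
                     (cong (λ L → A ++ (A ++ B) ++ [ L ]) (sym (two⊕¬first≡lit≐2 l₁ l₂)))

    X₁≤ : disjSize (A ++ (B ++ [ N₁ ])) ≤ a + (b + 2)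
    X₁≤ = disjSize-++-≤ A _ ≤-refl (disjSize-++-≤ B _ ≤-refl (+-mono-≤ (translateTerm-size (one (¬ₗ l₁))) z≤n))
    X₂≤ : disjSize (A ++ (A ++ B)) ≤ a + (a + b)
    X₂≤ = disjSize-++-≤ A _ ≤-refl (disjSize-++-≤ A B ≤-refl ≤-refl)
    bound₁ : ∀ a b → (a + (b + 2)) + ((a + (b + 2)) + 3) ≤ 4 * (a + b) + 8
    bound₁ a b = m+k≡n⇒m≤n (2 * a + 2 * b + 1) (slack a b)
      where
      slack : ∀ a b → (a + (b + 2)) + ((a + (b + 2)) + 3) + (2 * a + 2 * b + 1) ≡ 4 * (a + b) + 8
      slack = ℕ-Solver.solve-∀
    bound₂ : ∀ a b → (a + (a + b)) + ((a + (a + b)) + 3) ≤ 4 * (a + b) + 8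
    bound₂ a b = m+k≡n⇒m≤n (2 * b + 5) (slack a b)
      where
      slack : ∀ a b → (a + (a + b)) + ((a + (a + b)) + 3) + (2 * b + 5) ≡ 4 * (a + b) + 8
      slack = ℕ-Solver.solve-∀

-- Empty lines have size 0, so proof size bounds the number of lines only once
-- repeated empty lines are discarded.
hasEmpty : ∀ {n} → List (DNF2 n) → ℕ
hasEmpty []             = 0
hasEmpty ([] ∷ _)       = 1
hasEmpty ((_ ∷ _) ∷ ls) = hasEmpty ls

hasEmpty≤1 : ∀ {n} (ls : List (DNF2 n)) → hasEmpty ls ≤ 1
hasEmpty≤1 []             = z≤n
hasEmpty≤1 ([] ∷ _)       = ≤-refl
hasEmpty≤1 ((_ ∷ _) ∷ ls) = hasEmpty≤1 ls

[]∈⊎hasEmpty≡0 : ∀ {n} (ls : List (DNF2 n)) → [] ∈ ls ⊎ hasEmpty ls ≡ 0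
[]∈⊎hasEmpty≡0 []             = inj₂ refl
[]∈⊎hasEmpty≡0 ([] ∷ _)       = inj₁ (here refl)
[]∈⊎hasEmpty≡0 ((_ ∷ _) ∷ ls) with []∈⊎hasEmpty≡0 ls
... | inj₁ []∈ls = inj₁ (there []∈ls)
... | inj₂ none  = inj₂ none

budget : ∀ {n} → List (DNF2 n) → ℕ
budget ls = totalSize ls + hasEmpty ls

1≤termSize : ∀ {n} (T : Term n) → 1 ≤ termSize T
1≤termSize (one _)   = s≤s z≤n
1≤termSize (two _ _) = s≤s z≤n

module Simulation {n : ℕ} (K : List (DNF2 n)) where

  open Extensions (map translate K)

  lineBound : List (DNF2 n) → ℕ
  lineBound ls = 16 * suc (totalSize ls)

  blockBound : List (DNF2 n) → ℕ
  blockBound ls = 12 * lineBound ls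

  linesSize : List (Disj n) → ℕ
  linesSize R = sum (map disjSize R)

  cut-bound : ∀ {a b} d s → a ≤ 2 * s → b ≤ 2 * s → 4 * (a + b) + 8 ≤ 16 * suc (d + s)
  cut-bound d s a≤ b≤ =
    ≤-trans (+-monoˡ-≤ 8 (*-monoʳ-≤ 4 (+-mono-≤ a≤ b≤))) (m+k≡n⇒m≤n (16 * d + 8) (slack d s))
    where
    slack : ∀ d s → 4 * (2 * s + 2 * s) + 8 + (16 * d + 8) ≡ 16 * suc (d + s)
    slack = ℕ-Solver.solve-∀

  simulateCut : ∀ {R a b Y} d s (T : Term n) →
                Occ (a ++ [ translateTerm T ]) R → Occ (b ++ translate (negTerm T)) R → Y ≈ₛ (a ++ b) →
                disjSize a ≤ 2 * s → disjSize b ≤ 2 * s → Extension R Y 11 (16 * suc (d + s))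
  simulateCut {a = a} {b} d s (one l) a∨T b∨¬T Y≈ a≤ b≤ =
    Extension-mono (s≤s z≤n) (≤-trans (m+k≡n⇒m≤n (3 * (x + y) + 7) (slack x y)) (cut-bound d s a≤ b≤))
                   (cutOne l a∨T b∨¬T Y≈)
    where
    x y : ℕ
    x = disjSize a
    y = disjSize b
    slack : ∀ x y → x + (y + 1) + (3 * (x + y) + 7) ≡ 4 * (x + y) + 8
    slack = ℕ-Solver.solve-∀
  simulateCut d s (two l₁ l₂) a∨T b∨¬T Y≈ a≤ b≤ =
    Extension-mono ≤-refl (cut-bound d s a≤ b≤) (cutTwo l₁ l₂ a∨T b∨¬T Y≈)

  translate-≤-lineBound : ∀ {ls} (D : DNF2 n) → disjSize (translate D) ≤ lineBound (D ∷ ls)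
  translate-≤-lineBound {ls} D =
    ≤-trans (translate-size D)
            (m+k≡n⇒m≤n (14 * dnfSize D + 16 * totalSize ls + 16) (slack (dnfSize D) (totalSize ls)))
    where
    slack : ∀ d s → 2 * d + (14 * d + 16 * s + 16) ≡ 16 * suc (d + s)
    slack = ℕ-Solver.solve-∀

  simulateRule : ∀ {ls R D} → Simulates ls R → Res2Rule K ls D →
                 Extension R (translate D) 11 (lineBound (D ∷ ls))
  simulateRule sim (axiom D∈K) = Extension-mono z≤n ≤-refl (byRule (axiom (∈-map⁺ translate D∈K)))
  simulateRule sim (weaken A T A∈ D≈) = Extension-mono z≤n ≤-refl $
    byRule (weaken (translate A) (translateTerm T) (translate-Occ sim A∈) (translate-≈ₛ {A = A} {[ T ]} D≈))
  simulateRule sim (and-intro A B l₁ l₂ A∨l₁ B∨l₂ D≈) = Extension-mono z≤n ≤-refl $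
    byRule (res-plus (translate A) (translate B) (translateTerm (one l₁)) (translateTerm (one l₂))
             (translate-Occ-++ {A = A} {Z = [ one l₁ ]} sim A∨l₁)
             (translate-Occ-++ {A = B} {Z = [ one l₂ ]} sim B∨l₂)
             (≈ₛ-trans (translate-≈ₛ {A = A} {B ++ [ two l₁ l₂ ]} D≈) (≡⇒≈ₛ (cong (translate A ++_) B∨l₁∧l₂≡))))
    where
    B∨l₁∧l₂≡ : translate (B ++ [ two l₁ l₂ ]) ≡ translate B ++ [ translateTerm (one l₁) ⊕ translateTerm (one l₂) ]
    B∨l₁∧l₂≡ = trans (map-++ translateTerm B [ two l₁ l₂ ])
                     (cong (λ L → translate B ++ [ L ]) (sym (one⊕one≡two l₁ l₂)))
  simulateRule {ls} {D = D} sim (cut A B T A∨T B∨¬T D≈)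
    with small-side {A = A} {Z = [ T ]} A∨T | small-side {A = B} {Z = negTerm T} B∨¬T
  ... | A′ , A′≈A , A′≤ , A′∨T | B′ , B′≈B , B′≤ , B′∨¬T =
    simulateCut (dnfSize D) (totalSize ls) T
      (translate-Occ-++ {A = A′} {Z = [ T ]} sim A′∨T)
      (translate-Occ-++ {A = B′} {Z = negTerm T} sim B′∨¬T)
      (≈ₛ-trans (translate-≈ₛ {A = A} {B} D≈)
                (++-cong-≈ₛ (map-cong-≈ₛ translateTerm (≈ₛ-sym A′≈A)) (map-cong-≈ₛ translateTerm (≈ₛ-sym B′≈B))))
      (≤-trans (translate-size A′) (*-monoʳ-≤ 2 A′≤))
      (≤-trans (translate-size B′) (*-monoʳ-≤ 2 B′≤))

  blockBound-mono : ∀ (D : DNF2 n) ls → blockBound ls ≤ blockBound (D ∷ ls)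
  blockBound-mono D ls = *-monoʳ-≤ 12 (*-monoʳ-≤ 16 (s≤s (m≤n+m (totalSize ls) (dnfSize D))))

  record Simulated (ls : List (DNF2 n)) (blocks : ℕ) : Set where
    constructor simulated
    field
      lines      : List (Disj n)
      derivation : RlinDeriv (map translate K) lines
      simulates  : Simulates ls lines
      size-bound : linesSize lines ≤ blocks * blockBound ls

  Simulated-mono : ∀ {ls b b′} → b ≤ b′ → Simulated ls b → Simulated ls b′
  Simulated-mono {ls} b≤b′ (simulated R d sim R≤) = simulated R d sim (≤-trans R≤ (*-monoˡ-≤ (blockBound ls) b≤b′))

  append : ∀ {ls D b} → Simulated ls b → Res2Rule K ls D →
           Σ[ R ∈ List (Disj n) ] RlinDeriv (map translate K) (translate D ∷ R) ×
                                  Simulates (D ∷ ls) (translate D ∷ R) ×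
                                  linesSize (translate D ∷ R) ≤ suc b * blockBound (D ∷ ls)
  append {ls} {D} {b} (simulated R d sim R≤) r with simulateRule sim r d
  ... | aux , d′ , aux≤11 , aux≤L = aux ++ R , d′ , sim′ , size
    where
    L : ℕ
    L = lineBound (D ∷ ls)
    sim′ : Simulates (D ∷ ls) (translate D ∷ aux ++ R)
    sim′ (here refl) = Occ-head ≈ₛ-refl
    sim′ (there E∈)  = Occ-++ (translate D ∷ aux) (sim E∈)
    size : linesSize (translate D ∷ aux ++ R) ≤ suc b * blockBound (D ∷ ls)
    size = begin
      disjSize (translate D) + linesSize (aux ++ R)
        ≡⟨ cong (λ x → disjSize (translate D) + x) (sum-map-++ disjSize aux R) ⟩
      disjSize (translate D) + (linesSize aux + linesSize R)
        ≤⟨ +-mono-≤ (translate-≤-lineBound {ls} D)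
                    (+-mono-≤ (≤-trans (sum-map-≤-length* disjSize aux≤L) (*-monoˡ-≤ L aux≤11))
                              (≤-trans R≤ (*-monoʳ-≤ b (blockBound-mono D ls)))) ⟩
      L + (11 * L + b * blockBound (D ∷ ls))
        ≡⟨ sym (+-assoc L (11 * L) _) ⟩
      suc b * blockBound (D ∷ ls) ∎
      where open ≤-Reasoning

  append-Simulated : ∀ {ls D b} → Simulated ls b → Res2Rule K ls D → Simulated (D ∷ ls) (suc b)
  append-Simulated {D = D} s r =
    let R , d , sim , R≤ = append s r in simulated (translate D ∷ R) d sim R≤

  extend : ∀ {ls D} → Simulated ls (budget ls) → Res2Rule K ls D → Simulated (D ∷ ls) (budget (D ∷ ls))
  extend {ls} {t ∷ ts} s r =
    Simulated-mono (+-monoˡ-≤ (hasEmpty ls) (+-monoˡ-≤ (totalSize ls) (≤-trans (1≤termSize t) (m≤m+n _ _))))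
                   (append-Simulated s r)
  extend {ls} {[]} s r with []∈⊎hasEmpty≡0 ls
  ... | inj₂ none = Simulated-mono (≤-reflexive (trans (cong (λ h → suc (totalSize ls + h)) none)
                                                       (sym (+-suc (totalSize ls) 0))))
                                   (append-Simulated s r)
  ... | inj₁ []∈ls =
    simulated R d sim′ (≤-trans R≤ (*-monoˡ-≤ (blockBound ls) (+-monoʳ-≤ (totalSize ls) (hasEmpty≤1 ls))))
    where
    open Simulated s renaming (lines to R; derivation to d; simulates to sim; size-bound to R≤)
    sim′ : Simulates ([] ∷ ls) R
    sim′ (here refl) = sim []∈ls
    sim′ (there E∈)  = sim E∈

  simulate : ∀ {ls} → Res2Deriv K ls → Simulated ls (budget ls)
  simulate []      = simulated [] [] (λ ()) z≤n
  simulate (π ▷ r) = extend (simulate π) r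

  blocks-bound : ∀ d s {h} → h ≤ 1 → suc (s + h) * (12 * (16 * suc (d + s))) ≤ 384 * suc (d + s) ^ 2
  blocks-bound d s {h} h≤1 = begin
    suc (s + h) * B          ≤⟨ *-monoˡ-≤ B (s≤s (+-mono-≤ (m≤n+m s d) h≤1)) ⟩
    suc (d + s + 1) * B      ≤⟨ *-monoˡ-≤ B (m+k≡n⇒m≤n {suc (d + s + 1)} (d + s) (slack (d + s))) ⟩
    2 * suc (d + s) * B      ≡⟨ square (d + s) ⟩
    384 * suc (d + s) ^ 2    ∎
    where
    open ≤-Reasoning
    B : ℕ
    B = 12 * (16 * suc (d + s))
    slack : ∀ S → suc (S + 1) + S ≡ 2 * suc S
    slack = ℕ-Solver.solve-∀
    square : ∀ S → 2 * suc S * (12 * (16 * suc S)) ≡ 384 * (suc S * (suc S * 1))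
    square = ℕ-Solver.solve-∀

  rlinProof : ∀ {D} (π : Res2Proof n K D) →
              Σ (RlinProof n (map translate K) (translate D)) λ ρ → rlinSize ρ ≤ 384 * suc (res2Size π) ^ 2
  rlinProof {D} (ls , π ▷ r) =
    let R , d , _ , R≤ = append (simulate π) r
    in (R , d) , ≤-trans R≤ (blocks-bound (dnfSize D) (totalSize ls) (hasEmpty≤1 ls))

proposition6p13 : Σ ℕ λ c → Σ ℕ λ d →
    ∀ (n : ℕ) (K : List (DNF2 n)) (D : DNF2 n) (π : Res2Proof n K D) →
      Σ (RlinProof n (map translate K) (translate D)) λ ρ →
        rlinSize ρ ≤ c * (suc (res2Size π)) ^ d
proposition6p13 = 384 , 2 , λ n K D π → Simulation.rlinProof K π
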